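{- Let $d=p^2+4q$. For all integers $m,n\ge 1$, \begin{align*} V_{n}^{2}-dU_{n}^{2}&=(-q)^{n-1}\left(V_{1}^{2}-dU_{1}^{2}\right)=4(-q)^{n}\left(V_{0}+\left(-1+q-q^{2}+q^{3}\right)\right),\\ v_{m}V_{n}+du_{m}U_{n}&=2V_{m+n},\\ u_{m}V_{n}+v_{m}U_{n}&=2U_{m+n},\\ V_{m}V_{n}+dU_{m}U_{n}&=V_{1}V_{m+n-1}+dU_{1}U_{m+n-1},\\ U_{m}V_{n}+V_{m}U_{n}&=U_{1}V_{m+n-1}+V_{1}U_{m+n-1}. \end{align*}
   Context: Let $H$ be the real quaternion algebra with basis $1,i,j,k$ and (non-commutative) multiplication determined by $i^2=j^2=k^2=-1$, $ij=-ji=k$, $jk=-kj=i$, $ki=-ik=j$; real scalars commute with all quaternions. Fix real numbers $p,q$. For real $a,b$, the Horadam sequence $w_n(a,b;p,q)$ is defined by $w_0=a$, $w_1=b$, $w_n=pw_{n-1}+qw_{n-2}$ for $n\ge 2$. Let $u_n=w_n(0,1;p,q)$ (the $(p,q)$-Fibonacci numbers) and $v_n=w_n(2,p;p,q)$ (the $(p,q)$-Lucas numbers). The $(p,q)$-Fibonacci quaternions are $U_n=u_n+u_{n+1}i+u_{n+2}j+u_{n+3}k$ and the $(p,q)$-Lucas quaternions are $V_n=v_n+v_{n+1}i+v_{n+2}j+v_{n+3}k$. Here $X^2=XX$. -}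

module Defs where

open import Level using (Level)
open import Data.Nat using (ℕ; zero; suc)
open import Data.Product using (_×_)
open import Algebra.Bundles using (CommutativeRing)

module Quat {c ℓ : Level} (R : CommutativeRing c ℓ) where
  open CommutativeRing R

  record H : Set c where
    constructor quat
    field
      re : Carrier
      ci : Carrier
      cj : Carrier
      ck : Carrier
  open H public

  _≈H_ : H → H → Set ℓ
  x ≈H y = (re x ≈ re y) × (ci x ≈ ci y) × (cj x ≈ cj y) × (ck x ≈ ck y)

  _+H_ : H → H → H
  x +H y = quat (re x + re y) (ci x + ci y) (cj x + cj y) (ck x + ck y)

  _-H_ : H → H → H
  x -H y = quat (re x - re y) (ci x - ci y) (cj x - cj y) (ck x - ck y)

  _·H_ : Carrier → H → H
  s ·H x = quat (s * re x) (s * ci x) (s * cj x) (s * ck x)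

  ι : Carrier → H
  ι s = quat s 0# 0# 0#

  -- Hamilton product (i² = j² = k² = -1, ij = k, jk = i, ki = j)
  _*H_ : H → H → H
  x *H y = quat
    (re x * re y - ci x * ci y - cj x * cj y - ck x * ck y)
    (re x * ci y + ci x * re y + cj x * ck y - ck x * cj y)
    (re x * cj y - ci x * ck y + cj x * re y + ck x * ci y)
    (re x * ck y + ci x * cj y - cj x * ci y + ck x * re y)

  sq : H → H
  sq x = x *H x

  pow : Carrier → ℕ → Carrier
  pow x zero = 1#
  pow x (suc n) = x * pow x n

  two : Carrier
  two = 1# + 1#

  four : Carrier
  four = two + two

  w : Carrier → Carrier → Carrier → Carrier → ℕ → Carrier
  w a b p q zero = a
  w a b p q (suc zero) = b
  w a b p q (suc (suc n)) = p * w a b p q (suc n) + q * w a b p q n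

  u : Carrier → Carrier → ℕ → Carrier
  u p q = w 0# 1# p q

  v : Carrier → Carrier → ℕ → Carrier
  v p q = w two p p q

  U : Carrier → Carrier → ℕ → H
  U p q n = quat (u p q n) (u p q (suc n)) (u p q (suc (suc n))) (u p q (suc (suc (suc n))))

  V : Carrier → Carrier → ℕ → H
  V p q n = quat (v p q n) (v p q (suc n)) (v p q (suc (suc n))) (v p q (suc (suc (suc n))))

-- Two observations carry the whole proof.
-- (1) Scalar identities via uniqueness of Horadam sequences: a sequence
--     satisfying f (n+2) = p f (n+1) + q f n is determined by f 0 and f 1,
--     and such sequences are closed under sums, scalar multiples and shifts.
--     Hence two-index identities such as L a L b + d F a F b = 2 L (a+b) and
--     L (a+1) L (b+1) - d F (a+1) F (b+1) = -q (L a L b - d F a F b) follow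
--     by induction on one index and then the other, from four base values.
-- (2) The Hamilton product is bilinear: X Y = hamilton (λ i j → X_i Y_j)
--     for a fixed signed pattern 'hamilton' of the sixteen coordinate
--     products, and 'hamilton' is linear.  Each quaternion identity thus
--     reduces entrywise to a scalar identity of (1), where the entries only
--     depend on index sums (products) or shift by a factor -q (norms).
module Submission where

open import Level using (Level)
open import Data.Nat using (ℕ; zero; suc; _≤_; _∸_; s≤s; z≤n) renaming (_+_ to _+ℕ_; _*_ to _*ℕ_)
import Data.Nat.Properties as ℕP
open import Data.Integer as ℤ using (ℤ; +_; -[1+_]; _⊖_; sign; ∣_∣; _◃_)
import Data.Integer.Properties as ℤP
open import Data.Sign as Sign using (Sign)
open import Data.Product using (_×_; _,_; proj₁)
open import Data.Maybe using (Maybe; just; nothing)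
open import Relation.Nullary using (yes; no)
open import Relation.Binary.Bundles using (Setoid)
import Relation.Binary.PropositionalEquality as P
open import Algebra.Bundles using (CommutativeRing)
import Algebra.Solver.Ring.AlmostCommutativeRing as ACR
import Algebra.Solver.Ring as Solver
import Algebra.Properties.Ring as RingProps
import Algebra.Properties.AbelianGroup as AbelianGroupProps
import Algebra.Properties.CommutativeSemigroup as CommSemigroupProps
import Algebra.Properties.Monoid.Mult.TCOptimised as MonoidMult
import Algebra.Properties.Semiring.Mult.TCOptimised as SemiringMult
import Relation.Binary.Reasoning.Setoid as SetoidReasoning
open import Defs

-- Integer
-- coefficients make cancellations such as x - x = 0 decidable.
module IntegerRingSolver {c ℓ : Level} (R : CommutativeRing c ℓ) where
  open CommutativeRing R
  open RingProps ring using (-1*x≈-x)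
  open AbelianGroupProps +-abelianGroup using (⁻¹-∙-comm; ε⁻¹≈ε; ⁻¹-involutive)
  open MonoidMult +-monoid using (×-homo-+; 1+×) renaming (_×_ to _⊠_)
  open SemiringMult semiring using (×1-homo-*)
  open CommSemigroupProps +-commutativeSemigroup using () renaming (interchange to +-interchange)
  open CommSemigroupProps *-commutativeSemigroup using () renaming (interchange to *-interchange)
  open SetoidReasoning setoid

  ⟦_⟧ℤ : ℤ → Carrier
  ⟦ + n ⟧ℤ = n ⊠ 1#
  ⟦ -[1+ n ] ⟧ℤ = - (suc n ⊠ 1#)

  ⟦_⟧sign : Sign → Carrier
  ⟦ Sign.+ ⟧sign = 1#
  ⟦ Sign.- ⟧sign = - 1#

  ⊖-homo : ∀ m n → ⟦ m ⊖ n ⟧ℤ ≈ m ⊠ 1# - n ⊠ 1#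
  ⊖-homo zero zero = sym (trans (+-congˡ ε⁻¹≈ε) (+-identityʳ _))
  ⊖-homo (suc m) zero = sym (trans (+-congˡ ε⁻¹≈ε) (+-identityʳ _))
  ⊖-homo zero (suc n) = sym (+-identityˡ _)
  ⊖-homo (suc m) (suc n) = begin
    ⟦ suc m ⊖ suc n ⟧ℤ                    ≡⟨ P.cong ⟦_⟧ℤ (ℤP.[1+m]⊖[1+n]≡m⊖n m n) ⟩
    ⟦ m ⊖ n ⟧ℤ                            ≈⟨ ⊖-homo m n ⟩
    m ⊠ 1# - n ⊠ 1#                       ≈⟨ sym (+-identityˡ _) ⟩
    0# + (m ⊠ 1# - n ⊠ 1#)                ≈⟨ +-congʳ (sym (-‿inverseʳ 1#)) ⟩
    (1# - 1#) + (m ⊠ 1# - n ⊠ 1#)         ≈⟨ +-interchange 1# (- 1#) (m ⊠ 1#) (- (n ⊠ 1#)) ⟩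
    (1# + m ⊠ 1#) + (- 1# + - (n ⊠ 1#))   ≈⟨ +-cong (sym (1+× m 1#)) (trans (⁻¹-∙-comm 1# (n ⊠ 1#)) (-‿cong (sym (1+× n 1#)))) ⟩
    suc m ⊠ 1# - suc n ⊠ 1#               ∎

  sign-abs : ∀ i → ⟦ i ⟧ℤ ≈ ⟦ sign i ⟧sign * (∣ i ∣ ⊠ 1#)
  sign-abs (+ n) = sym (*-identityˡ _)
  sign-abs -[1+ n ] = sym (-1*x≈-x _)

  ◃-homo : ∀ s n → ⟦ s ◃ n ⟧ℤ ≈ ⟦ s ⟧sign * (n ⊠ 1#)
  ◃-homo s zero = sym (zeroʳ _)
  ◃-homo Sign.+ (suc n) = sym (*-identityˡ _)
  ◃-homo Sign.- (suc n) = sym (-1*x≈-x _)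

  sign-*-homo : ∀ s t → ⟦ s Sign.* t ⟧sign ≈ ⟦ s ⟧sign * ⟦ t ⟧sign
  sign-*-homo Sign.+ Sign.+ = sym (*-identityˡ _)
  sign-*-homo Sign.+ Sign.- = sym (*-identityˡ _)
  sign-*-homo Sign.- Sign.+ = sym (*-identityʳ _)
  sign-*-homo Sign.- Sign.- = sym (trans (-1*x≈-x _) (⁻¹-involutive _))

  *-homo : ∀ i j → ⟦ i ℤ.* j ⟧ℤ ≈ ⟦ i ⟧ℤ * ⟦ j ⟧ℤ
  *-homo i j = begin
    ⟦ i ℤ.* j ⟧ℤ
      ≈⟨ ◃-homo (sign i Sign.* sign j) (∣ i ∣ *ℕ ∣ j ∣) ⟩
    ⟦ sign i Sign.* sign j ⟧sign * ((∣ i ∣ *ℕ ∣ j ∣) ⊠ 1#)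
      ≈⟨ *-cong (sign-*-homo (sign i) (sign j)) (×1-homo-* ∣ i ∣ ∣ j ∣) ⟩
    (⟦ sign i ⟧sign * ⟦ sign j ⟧sign) * ((∣ i ∣ ⊠ 1#) * (∣ j ∣ ⊠ 1#))
      ≈⟨ *-interchange _ _ _ _ ⟩
    (⟦ sign i ⟧sign * (∣ i ∣ ⊠ 1#)) * (⟦ sign j ⟧sign * (∣ j ∣ ⊠ 1#))
      ≈⟨ *-cong (sym (sign-abs i)) (sym (sign-abs j)) ⟩
    ⟦ i ⟧ℤ * ⟦ j ⟧ℤ ∎

  +-homo : ∀ i j → ⟦ i ℤ.+ j ⟧ℤ ≈ ⟦ i ⟧ℤ + ⟦ j ⟧ℤ
  +-homo (+ m) (+ n) = ×-homo-+ 1# m n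
  +-homo (+ m) -[1+ n ] = ⊖-homo m (suc n)
  +-homo -[1+ m ] (+ n) = trans (⊖-homo n (suc m)) (+-comm _ _)
  +-homo -[1+ m ] -[1+ n ] = begin
    - (suc (suc (m +ℕ n)) ⊠ 1#)   ≡⟨ P.cong (λ k → - (k ⊠ 1#)) (P.sym (ℕP.+-suc (suc m) n)) ⟩
    - ((suc m +ℕ suc n) ⊠ 1#)     ≈⟨ -‿cong (×-homo-+ 1# (suc m) (suc n)) ⟩
    - (suc m ⊠ 1# + suc n ⊠ 1#)   ≈⟨ sym (⁻¹-∙-comm _ _) ⟩
    - (suc m ⊠ 1#) + - (suc n ⊠ 1#) ∎

  neg-homo : ∀ i → ⟦ ℤ.- i ⟧ℤ ≈ - ⟦ i ⟧ℤ
  neg-homo (+ zero) = sym ε⁻¹≈ε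
  neg-homo (+ suc n) = refl
  neg-homo -[1+ n ] = sym (⁻¹-involutive _)

  integerMorphism : ℤ.+-*-rawRing ACR.-Raw-AlmostCommutative⟶ ACR.fromCommutativeRing R
  integerMorphism = record
    { ⟦_⟧ = ⟦_⟧ℤ ; +-homo = +-homo ; *-homo = *-homo ; -‿homo = neg-homo
    ; 0-homo = refl ; 1-homo = refl }

  coefficient-equality : ∀ i j → Maybe (⟦ i ⟧ℤ ≈ ⟦ j ⟧ℤ)
  coefficient-equality i j with i ℤ.≟ j
  ... | yes P.refl = just refl
  ... | no _ = nothing

  open Solver ℤ.+-*-rawRing (ACR.fromCommutativeRing R) integerMorphism coefficient-equality public

module HoradamScalars {c ℓ : Level} (R : CommutativeRing c ℓ) (p q : CommutativeRing.Carrier R) where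
  open CommutativeRing R
  open Quat R using (u; v; two; four; pow)
  open IntegerRingSolver R
  open SetoidReasoning setoid

  F L : ℕ → Carrier
  F = u p q
  L = v p q

  d : Carrier
  d = p * p + four * q

  -- Solver-side counterparts of w, F, L and d, for checking base values
  -- (p and q are solver variables P and Q).
  wₚ : ∀ {N} → (A B P Q : Polynomial N) → ℕ → Polynomial N
  wₚ A B P Q zero = A
  wₚ A B P Q (suc zero) = B
  wₚ A B P Q (suc (suc n)) = P :* wₚ A B P Q (suc n) :+ Q :* wₚ A B P Q n

  Fₚ Lₚ : ∀ {N} → (P Q : Polynomial N) → ℕ → Polynomial N
  Fₚ P Q = wₚ (con (+ 0)) (con (+ 1)) P Q
  Lₚ P Q = wₚ (con (+ 2)) P P Q

  dₚ : ∀ {N} → (P Q : Polynomial N) → Polynomial N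
  dₚ P Q = P :* P :+ (con (+ 2) :+ con (+ 2)) :* Q

  Rec : (ℕ → Carrier) → Set ℓ
  Rec f = ∀ n → f (suc (suc n)) ≈ p * f (suc n) + q * f n

  rec-F : Rec F
  rec-F n = refl

  rec-L : Rec L
  rec-L n = refl

  rec-+ : ∀ {f g} → Rec f → Rec g → Rec (λ n → f n + g n)
  rec-+ {f} {g} rf rg n = trans (+-cong (rf n) (rg n))
    (solve 6 (λ P Q x₁ x₀ y₁ y₀ → (P :* x₁ :+ Q :* x₀) :+ (P :* y₁ :+ Q :* y₀)
                                  := P :* (x₁ :+ y₁) :+ Q :* (x₀ :+ y₀))
       refl p q (f (suc n)) (f n) (g (suc n)) (g n))

  rec-- : ∀ {f g} → Rec f → Rec g → Rec (λ n → f n - g n)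
  rec-- {f} {g} rf rg n = trans (+-cong (rf n) (-‿cong (rg n)))
    (solve 6 (λ P Q x₁ x₀ y₁ y₀ → (P :* x₁ :+ Q :* x₀) :- (P :* y₁ :+ Q :* y₀)
                                  := P :* (x₁ :- y₁) :+ Q :* (x₀ :- y₀))
       refl p q (f (suc n)) (f n) (g (suc n)) (g n))

  rec-*ˡ : ∀ α {f} → Rec f → Rec (λ n → α * f n)
  rec-*ˡ α {f} rf n = trans (*-congˡ (rf n))
    (solve 5 (λ P Q a x₁ x₀ → a :* (P :* x₁ :+ Q :* x₀) := P :* (a :* x₁) :+ Q :* (a :* x₀))
       refl p q α (f (suc n)) (f n))

  rec-*ʳ : ∀ α {f} → Rec f → Rec (λ n → f n * α)
  rec-*ʳ α {f} rf n = trans (*-congʳ (rf n))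
    (solve 5 (λ P Q a x₁ x₀ → (P :* x₁ :+ Q :* x₀) :* a := P :* (x₁ :* a) :+ Q :* (x₀ :* a))
       refl p q α (f (suc n)) (f n))

  rec-suc : ∀ {f} → Rec f → Rec (λ n → f (suc n))
  rec-suc rf n = rf (suc n)

  rec-+ʳ : ∀ k {f} → Rec f → Rec (λ n → f (n +ℕ k))
  rec-+ʳ k rf n = rf (n +ℕ k)

  rec-unique : ∀ {f g} → Rec f → Rec g → f 0 ≈ g 0 → f 1 ≈ g 1 → ∀ n → f n ≈ g n
  rec-unique {f} {g} rf rg f₀≈g₀ f₁≈g₁ n = proj₁ (agree n)
    where
    agree : ∀ n → (f n ≈ g n) × (f (suc n) ≈ g (suc n))
    agree zero = f₀≈g₀ , f₁≈g₁
    agree (suc n) with agree n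
    ... | fₙ≈gₙ , fₙ₊₁≈gₙ₊₁ =
      fₙ₊₁≈gₙ₊₁ , trans (rf n) (trans (+-cong (*-congˡ fₙ₊₁≈gₙ₊₁) (*-congˡ fₙ≈gₙ)) (sym (rg n)))

  Lucas-sum : ∀ a b → L a * L b + d * (F a * F b) ≈ two * L (a +ℕ b)
  Lucas-sum a b =
    rec-unique (rec-+ (rec-*ʳ (L b) rec-L) (rec-*ˡ d (rec-*ʳ (F b) rec-F)))
               (rec-*ˡ two (rec-+ʳ b rec-L))
               (at-0 b) (at-1 b) a
    where
    at-0 : ∀ b → L 0 * L b + d * (F 0 * F b) ≈ two * L b
    at-0 b = solve 3 (λ D x y → con (+ 2) :* x :+ D :* (con (+ 0) :* y) := con (+ 2) :* x) refl d (L b) (F b)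
    at-1 : ∀ b → L 1 * L b + d * (F 1 * F b) ≈ two * L (suc b)
    at-1 = rec-unique (rec-+ (rec-*ˡ (L 1) rec-L) (rec-*ˡ d (rec-*ˡ (F 1) rec-F)))
                      (rec-*ˡ two (rec-suc rec-L))
                      (solve 2 (λ P Q → Lₚ P Q 1 :* Lₚ P Q 0 :+ dₚ P Q :* (Fₚ P Q 1 :* Fₚ P Q 0)
                                        := con (+ 2) :* Lₚ P Q 1) refl p q)
                      (solve 2 (λ P Q → Lₚ P Q 1 :* Lₚ P Q 1 :+ dₚ P Q :* (Fₚ P Q 1 :* Fₚ P Q 1)
                                        := con (+ 2) :* Lₚ P Q 2) refl p q)

  mixed-sum : ∀ a b → F a * L b + L a * F b ≈ two * F (a +ℕ b)
  mixed-sum a b =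
    rec-unique (rec-+ (rec-*ʳ (L b) rec-F) (rec-*ʳ (F b) rec-L))
               (rec-*ˡ two (rec-+ʳ b rec-F))
               (at-0 b) (at-1 b) a
    where
    at-0 : ∀ b → F 0 * L b + L 0 * F b ≈ two * F b
    at-0 b = solve 2 (λ x y → con (+ 0) :* x :+ con (+ 2) :* y := con (+ 2) :* y) refl (L b) (F b)
    at-1 : ∀ b → F 1 * L b + L 1 * F b ≈ two * F (suc b)
    at-1 = rec-unique (rec-+ (rec-*ˡ (F 1) rec-L) (rec-*ˡ (L 1) rec-F))
                      (rec-*ˡ two (rec-suc rec-F))
                      (solve 2 (λ P Q → Fₚ P Q 1 :* Lₚ P Q 0 :+ Lₚ P Q 1 :* Fₚ P Q 0
                                        := con (+ 2) :* Fₚ P Q 1) refl p q)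
                      (solve 2 (λ P Q → Fₚ P Q 1 :* Lₚ P Q 1 :+ Lₚ P Q 1 :* Fₚ P Q 1
                                        := con (+ 2) :* Fₚ P Q 2) refl p q)

  -- The "norm form" N a b = L a L b - d F a F b; its diagonal N n n is
  -- the scalar shadow of V n² - d U n².
  N : ℕ → ℕ → Carrier
  N a b = L a * L b - d * (F a * F b)

  rec-Nˡ : ∀ b → Rec (λ a → N a b)
  rec-Nˡ b = rec-- (rec-*ʳ (L b) rec-L) (rec-*ˡ d (rec-*ʳ (F b) rec-F))

  rec-Nʳ : ∀ a → Rec (λ b → N a b)
  rec-Nʳ a = rec-- (rec-*ˡ (L a) rec-L) (rec-*ˡ d (rec-*ˡ (F a) rec-F))

  N-step : ∀ a b → N (suc a) (suc b) ≈ - q * N a b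
  N-step a b = rec-unique (rec-suc (rec-Nˡ (suc b))) (rec-*ˡ (- q) (rec-Nˡ b))
                          (along-b 0 (solve 2 (step-at 0 0) refl p q) (solve 2 (step-at 0 1) refl p q) b)
                          (along-b 1 (solve 2 (step-at 1 0) refl p q) (solve 2 (step-at 1 1) refl p q) b) a
    where
    along-b : ∀ a → N (suc a) 1 ≈ - q * N a 0 → N (suc a) 2 ≈ - q * N a 1 →
              ∀ b → N (suc a) (suc b) ≈ - q * N a b
    along-b a = rec-unique (rec-suc (rec-Nʳ (suc a))) (rec-*ˡ (- q) (rec-Nʳ a))
    step-at : ℕ → ℕ → Polynomial 2 → Polynomial 2 → Polynomial 2 × Polynomial 2
    step-at a b P Q =
      Lₚ P Q (suc a) :* Lₚ P Q (suc b) :- dₚ P Q :* (Fₚ P Q (suc a) :* Fₚ P Q (suc b))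
      := :- Q :* (Lₚ P Q a :* Lₚ P Q b :- dₚ P Q :* (Fₚ P Q a :* Fₚ P Q b))

  N-shift : ∀ k a b → N (k +ℕ a) (k +ℕ b) ≈ pow (- q) k * N a b
  N-shift zero a b = sym (*-identityˡ _)
  N-shift (suc k) a b = begin
    N (suc (k +ℕ a)) (suc (k +ℕ b))  ≈⟨ N-step (k +ℕ a) (k +ℕ b) ⟩
    - q * N (k +ℕ a) (k +ℕ b)        ≈⟨ *-congˡ (N-shift k a b) ⟩
    - q * (pow (- q) k * N a b)      ≈⟨ sym (*-assoc _ _ _) ⟩
    pow (- q) (suc k) * N a b        ∎

module QuaternionAlgebra {c ℓ : Level} (R : CommutativeRing c ℓ) where
  open CommutativeRing R
  open Quat R
  open IntegerRingSolver R using (solve; _:=_; _:+_; _:-_; _:*_)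
  open CommSemigroupProps *-commutativeSemigroup using (x∙yz≈yx∙z)

  H-setoid : Setoid c ℓ
  H-setoid = record
    { Carrier = H
    ; _≈_ = _≈H_
    ; isEquivalence = record
      { refl = refl , refl , refl , refl
      ; sym = λ (a , b , c , d) → sym a , sym b , sym c , sym d
      ; trans = λ (a , b , c , d) (a′ , b′ , c′ , d′) → trans a a′ , trans b b′ , trans c c′ , trans d d′
      }
    }

  ·H-cong : ∀ k {X Y} → X ≈H Y → (k ·H X) ≈H (k ·H Y)
  ·H-cong k (a , b , c , d) = *-congˡ a , *-congˡ b , *-congˡ c , *-congˡ d

  +H-cong : ∀ {X X′ Y Y′} → X ≈H X′ → Y ≈H Y′ → (X +H Y) ≈H (X′ +H Y′)
  +H-cong (a , b , c , d) (a′ , b′ , c′ , d′) = +-cong a a′ , +-cong b b′ , +-cong c c′ , +-cong d d′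

  -H-cong : ∀ {X X′ Y Y′} → X ≈H X′ → Y ≈H Y′ → (X -H Y) ≈H (X′ -H Y′)
  -H-cong (a , b , c , d) (a′ , b′ , c′ , d′) =
    +-cong a (-‿cong a′) , +-cong b (-‿cong b′) , +-cong c (-‿cong c′) , +-cong d (-‿cong d′)

  ·H-nested : ∀ a b X → (a ·H (b ·H X)) ≈H ((b * a) ·H X)
  ·H-nested a b X = x∙yz≈yx∙z a b (re X) , x∙yz≈yx∙z a b (ci X) , x∙yz≈yx∙z a b (cj X) , x∙yz≈yx∙z a b (ck X)

  -- The quaternion assembled from a 4×4 table e of coordinate products by
  -- the sign pattern of Hamilton's multiplication (indices 0..3 = 1, i, j, k).
  -- By definition of *H, X *H Y is hamilton of the table X_i Y_j.
  hamilton : (ℕ → ℕ → Carrier) → H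
  hamilton e = quat (e 0 0 - e 1 1 - e 2 2 - e 3 3) (e 0 1 + e 1 0 + e 2 3 - e 3 2)
                    (e 0 2 - e 1 3 + e 2 0 + e 3 1) (e 0 3 + e 1 2 - e 2 1 + e 3 0)

  hamilton-cong : ∀ {e f} → (∀ i j → e i j ≈ f i j) → hamilton e ≈H hamilton f
  hamilton-cong h = -c (-c (-c (h 0 0) (h 1 1)) (h 2 2)) (h 3 3)
                  , -c (+-cong (+-cong (h 0 1) (h 1 0)) (h 2 3)) (h 3 2)
                  , +-cong (+-cong (-c (h 0 2) (h 1 3)) (h 2 0)) (h 3 1)
                  , +-cong (-c (+-cong (h 0 3) (h 1 2)) (h 2 1)) (h 3 0)
    where
    -c : ∀ {a b x y} → a ≈ b → x ≈ y → a - x ≈ b - y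
    -c a≈b x≈y = +-cong a≈b (-‿cong x≈y)

  hamilton-+H : ∀ e f → (hamilton e +H hamilton f) ≈H hamilton (λ i j → e i j + f i j)
  hamilton-+H e f =
      solve 8 (λ a b c d a′ b′ c′ d′ → (a :- b :- c :- d) :+ (a′ :- b′ :- c′ :- d′)
                := (a :+ a′) :- (b :+ b′) :- (c :+ c′) :- (d :+ d′)) refl
        (e 0 0) (e 1 1) (e 2 2) (e 3 3) (f 0 0) (f 1 1) (f 2 2) (f 3 3)
    , solve 8 (λ a b c d a′ b′ c′ d′ → (a :+ b :+ c :- d) :+ (a′ :+ b′ :+ c′ :- d′)
                := (a :+ a′) :+ (b :+ b′) :+ (c :+ c′) :- (d :+ d′)) refl
        (e 0 1) (e 1 0) (e 2 3) (e 3 2) (f 0 1) (f 1 0) (f 2 3) (f 3 2)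
    , solve 8 (λ a b c d a′ b′ c′ d′ → (a :- b :+ c :+ d) :+ (a′ :- b′ :+ c′ :+ d′)
                := (a :+ a′) :- (b :+ b′) :+ (c :+ c′) :+ (d :+ d′)) refl
        (e 0 2) (e 1 3) (e 2 0) (e 3 1) (f 0 2) (f 1 3) (f 2 0) (f 3 1)
    , solve 8 (λ a b c d a′ b′ c′ d′ → (a :+ b :- c :+ d) :+ (a′ :+ b′ :- c′ :+ d′)
                := (a :+ a′) :+ (b :+ b′) :- (c :+ c′) :+ (d :+ d′)) refl
        (e 0 3) (e 1 2) (e 2 1) (e 3 0) (f 0 3) (f 1 2) (f 2 1) (f 3 0)

  hamilton--H : ∀ e f → (hamilton e -H hamilton f) ≈H hamilton (λ i j → e i j - f i j)
  hamilton--H e f =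
      solve 8 (λ a b c d a′ b′ c′ d′ → (a :- b :- c :- d) :- (a′ :- b′ :- c′ :- d′)
                := (a :- a′) :- (b :- b′) :- (c :- c′) :- (d :- d′)) refl
        (e 0 0) (e 1 1) (e 2 2) (e 3 3) (f 0 0) (f 1 1) (f 2 2) (f 3 3)
    , solve 8 (λ a b c d a′ b′ c′ d′ → (a :+ b :+ c :- d) :- (a′ :+ b′ :+ c′ :- d′)
                := (a :- a′) :+ (b :- b′) :+ (c :- c′) :- (d :- d′)) refl
        (e 0 1) (e 1 0) (e 2 3) (e 3 2) (f 0 1) (f 1 0) (f 2 3) (f 3 2)
    , solve 8 (λ a b c d a′ b′ c′ d′ → (a :- b :+ c :+ d) :- (a′ :- b′ :+ c′ :+ d′)
                := (a :- a′) :- (b :- b′) :+ (c :- c′) :+ (d :- d′)) refl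
        (e 0 2) (e 1 3) (e 2 0) (e 3 1) (f 0 2) (f 1 3) (f 2 0) (f 3 1)
    , solve 8 (λ a b c d a′ b′ c′ d′ → (a :+ b :- c :+ d) :- (a′ :+ b′ :- c′ :+ d′)
                := (a :- a′) :+ (b :- b′) :- (c :- c′) :+ (d :- d′)) refl
        (e 0 3) (e 1 2) (e 2 1) (e 3 0) (f 0 3) (f 1 2) (f 2 1) (f 3 0)

  hamilton-·H : ∀ k e → (k ·H hamilton e) ≈H hamilton (λ i j → k * e i j)
  hamilton-·H k e =
      solve 5 (λ k a b c d → k :* (a :- b :- c :- d) := k :* a :- k :* b :- k :* c :- k :* d) refl
        k (e 0 0) (e 1 1) (e 2 2) (e 3 3)
    , solve 5 (λ k a b c d → k :* (a :+ b :+ c :- d) := k :* a :+ k :* b :+ k :* c :- k :* d) refl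
        k (e 0 1) (e 1 0) (e 2 3) (e 3 2)
    , solve 5 (λ k a b c d → k :* (a :- b :+ c :+ d) := k :* a :- k :* b :+ k :* c :+ k :* d) refl
        k (e 0 2) (e 1 3) (e 2 0) (e 3 1)
    , solve 5 (λ k a b c d → k :* (a :+ b :- c :+ d) := k :* a :+ k :* b :- k :* c :+ k :* d) refl
        k (e 0 3) (e 1 2) (e 2 1) (e 3 0)

module FibonacciLucasQuaternions {c ℓ : Level} (R : CommutativeRing c ℓ) (p q : CommutativeRing.Carrier R) where
  open CommutativeRing R
  open Quat R
  open HoradamScalars R p q
  open QuaternionAlgebra R
  open IntegerRingSolver R using (solve; _:=_; _:+_; _:-_; _:*_; :-_; con)
  open CommSemigroupProps ℕP.+-commutativeSemigroup using (x∙yz≈y∙xz; x∙yz≈z∙xy) renaming (interchange to +ℕ-interchange)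
  open SetoidReasoning H-setoid

  -- the table of products of shifted terms: entry (i , j) is f (i + m) g (j + n);
  -- for sequences f, g it describes the Hamilton product of their quaternions
  products : (ℕ → Carrier) → (ℕ → Carrier) → ℕ → ℕ → ℕ → ℕ → Carrier
  products f g m n i j = f (i +ℕ m) * g (j +ℕ n)

  -- V m V n + d U m U n has entries 2 L (i + j + m + n): it depends on m + n only.
  Lucas-product : ∀ m n → ((V p q m *H V p q n) +H (d ·H (U p q m *H U p q n)))
                          ≈H hamilton (λ i j → two * L (i +ℕ j +ℕ (m +ℕ n)))
  Lucas-product m n = begin
    (V p q m *H V p q n) +H (d ·H (U p q m *H U p q n))
      ≡⟨⟩
    hamilton (products L L m n) +H (d ·H hamilton (products F F m n))
      ≈⟨ +H-cong (Setoid.refl H-setoid) (hamilton-·H d (products F F m n)) ⟩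
    hamilton (products L L m n) +H hamilton (λ i j → d * products F F m n i j)
      ≈⟨ hamilton-+H (products L L m n) (λ i j → d * products F F m n i j) ⟩
    hamilton (λ i j → L (i +ℕ m) * L (j +ℕ n) + d * (F (i +ℕ m) * F (j +ℕ n)))
      ≈⟨ hamilton-cong (λ i j → trans (Lucas-sum (i +ℕ m) (j +ℕ n))
                                      (reflexive (P.cong (λ k → two * L k) (+ℕ-interchange i m j n)))) ⟩
    hamilton (λ i j → two * L (i +ℕ j +ℕ (m +ℕ n))) ∎

  mixed-product : ∀ m n → ((U p q m *H V p q n) +H (V p q m *H U p q n))
                          ≈H hamilton (λ i j → two * F (i +ℕ j +ℕ (m +ℕ n)))
  mixed-product m n = begin
    (U p q m *H V p q n) +H (V p q m *H U p q n)
      ≡⟨⟩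
    hamilton (products F L m n) +H hamilton (products L F m n)
      ≈⟨ hamilton-+H (products F L m n) (products L F m n) ⟩
    hamilton (λ i j → F (i +ℕ m) * L (j +ℕ n) + L (i +ℕ m) * F (j +ℕ n))
      ≈⟨ hamilton-cong (λ i j → trans (mixed-sum (i +ℕ m) (j +ℕ n))
                                      (reflexive (P.cong (λ k → two * F k) (+ℕ-interchange i m j n)))) ⟩
    hamilton (λ i j → two * F (i +ℕ j +ℕ (m +ℕ n))) ∎

  Lucas-scalar : ∀ m n → ((L m ·H V p q n) +H ((d * F m) ·H U p q n)) ≈H (two ·H V p q (m +ℕ n))
  Lucas-scalar m n = coordinate 0 , coordinate 1 , coordinate 2 , coordinate 3
    where
    coordinate : ∀ j → L m * L (j +ℕ n) + d * F m * F (j +ℕ n) ≈ two * L (j +ℕ (m +ℕ n))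
    coordinate j = trans (+-congˡ (*-assoc d (F m) _))
                         (trans (Lucas-sum m (j +ℕ n)) (reflexive (P.cong (λ k → two * L k) (x∙yz≈y∙xz m j n))))

  Fibonacci-scalar : ∀ m n → ((F m ·H V p q n) +H (L m ·H U p q n)) ≈H (two ·H U p q (m +ℕ n))
  Fibonacci-scalar m n = coordinate 0 , coordinate 1 , coordinate 2 , coordinate 3
    where
    coordinate : ∀ j → F m * L (j +ℕ n) + L m * F (j +ℕ n) ≈ two * F (j +ℕ (m +ℕ n))
    coordinate j = trans (mixed-sum m (j +ℕ n)) (reflexive (P.cong (λ k → two * F k) (x∙yz≈y∙xz m j n)))

  norm : ℕ → H
  norm n = sq (V p q n) -H (d ·H sq (U p q n))

  norm-as-hamilton : ∀ n → norm n ≈H hamilton (λ i j → N (i +ℕ n) (j +ℕ n))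
  norm-as-hamilton n = begin
    hamilton (products L L n n) -H (d ·H hamilton (products F F n n))
      ≈⟨ -H-cong (Setoid.refl H-setoid) (hamilton-·H d (products F F n n)) ⟩
    hamilton (products L L n n) -H hamilton (λ i j → d * products F F n n i j)
      ≈⟨ hamilton--H (products L L n n) (λ i j → d * products F F n n i j) ⟩
    hamilton (λ i j → N (i +ℕ n) (j +ℕ n)) ∎

  norm-shift : ∀ n k → norm (n +ℕ k) ≈H (pow (- q) k ·H norm n)
  norm-shift n k = begin
    norm (n +ℕ k)
      ≈⟨ norm-as-hamilton (n +ℕ k) ⟩
    hamilton (λ i j → N (i +ℕ (n +ℕ k)) (j +ℕ (n +ℕ k)))
      ≈⟨ hamilton-cong shifted ⟩
    hamilton (λ i j → pow (- q) k * N (i +ℕ n) (j +ℕ n))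
      ≈⟨ hamilton-·H (pow (- q) k) (λ i j → N (i +ℕ n) (j +ℕ n)) ⟨
    pow (- q) k ·H hamilton (λ i j → N (i +ℕ n) (j +ℕ n))
      ≈⟨ ·H-cong (pow (- q) k) (norm-as-hamilton n) ⟨
    pow (- q) k ·H norm n ∎
    where
    shifted : ∀ i j → N (i +ℕ (n +ℕ k)) (j +ℕ (n +ℕ k)) ≈ pow (- q) k * N (i +ℕ n) (j +ℕ n)
    shifted i j = trans (reflexive (P.cong₂ N (x∙yz≈z∙xy i n k) (x∙yz≈z∙xy j n k)))
                        (N-shift k (i +ℕ n) (j +ℕ n))

  norm-zero : norm 0 ≈H (four ·H (V p q 0 +H ι (- 1# + q - q * q + q * q * q)))
  norm-zero = Setoid.trans H-setoid (norm-as-hamilton 0)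
    ( solve 2 (λ P Q → Nₚ P Q 0 0 :- Nₚ P Q 1 1 :- Nₚ P Q 2 2 :- Nₚ P Q 3 3
                       := four′ :* (Lₚ P Q 0 :+ (:- con (+ 1) :+ Q :- Q :* Q :+ Q :* Q :* Q))) refl p q
    , solve 2 (λ P Q → Nₚ P Q 0 1 :+ Nₚ P Q 1 0 :+ Nₚ P Q 2 3 :- Nₚ P Q 3 2
                       := four′ :* (Lₚ P Q 1 :+ con (+ 0))) refl p q
    , solve 2 (λ P Q → Nₚ P Q 0 2 :- Nₚ P Q 1 3 :+ Nₚ P Q 2 0 :+ Nₚ P Q 3 1
                       := four′ :* (Lₚ P Q 2 :+ con (+ 0))) refl p q
    , solve 2 (λ P Q → Nₚ P Q 0 3 :+ Nₚ P Q 1 2 :- Nₚ P Q 2 1 :+ Nₚ P Q 3 0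
                       := four′ :* (Lₚ P Q 3 :+ con (+ 0))) refl p q )
    where
    four′ = con (+ 2) :+ con (+ 2)
    Nₚ = λ P Q a b → Lₚ P Q a :* Lₚ P Q b :- dₚ P Q :* (Fₚ P Q a :* Fₚ P Q b)

  -- (-q)^k (V 1² - d U 1²) = 4 (-q)^(k+1) (V 0 + c): both equal the norm at k + 1.
  norm-closed-form : ∀ k → (pow (- q) k ·H norm 1)
                           ≈H ((four * pow (- q) (suc k)) ·H (V p q 0 +H ι (- 1# + q - q * q + q * q * q)))
  norm-closed-form k = begin
    pow (- q) k ·H norm 1                 ≈⟨ norm-shift 1 k ⟨
    norm (suc k)                          ≈⟨ norm-shift 0 (suc k) ⟩
    pow (- q) (suc k) ·H norm 0           ≈⟨ ·H-cong (pow (- q) (suc k)) norm-zero ⟩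
    pow (- q) (suc k) ·H (four ·H W)      ≈⟨ ·H-nested (pow (- q) (suc k)) four W ⟩
    (four * pow (- q) (suc k)) ·H W       ∎
    where
    W : H
    W = V p q 0 +H ι (- 1# + q - q * q + q * q * q)

-- Theorem 2.5.  For m, n ≥ 1 write m = 1 + m′ and n = 1 + k; the
-- product identities compare (m, n) with (1, m′ + n), which have the same
-- index sum, and the norm identities are norm-shift and norm-closed-form.
theorem2p5 : ∀ {c ℓ : Level} (R : CommutativeRing c ℓ) →
  let open CommutativeRing R
      open Quat R
  in (p q : Carrier) (m n : ℕ) → 1 ≤ m → 1 ≤ n →
  let d = p * p + four * q
  in ((sq (V p q n) -H (d ·H sq (U p q n)))
        ≈H (pow (- q) (n ∸ 1) ·H (sq (V p q 1) -H (d ·H sq (U p q 1)))))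
   × ((pow (- q) (n ∸ 1) ·H (sq (V p q 1) -H (d ·H sq (U p q 1))))
        ≈H ((four * pow (- q) n) ·H (V p q 0 +H ι (- 1# + q - q * q + q * q * q))))
   × (((v p q m ·H V p q n) +H ((d * u p q m) ·H U p q n)) ≈H (two ·H V p q (m +ℕ n)))
   × (((u p q m ·H V p q n) +H (v p q m ·H U p q n)) ≈H (two ·H U p q (m +ℕ n)))
   × (((V p q m *H V p q n) +H (d ·H (U p q m *H U p q n)))
        ≈H ((V p q 1 *H V p q (m +ℕ n ∸ 1)) +H (d ·H (U p q 1 *H U p q (m +ℕ n ∸ 1)))))
   × (((U p q m *H V p q n) +H (V p q m *H U p q n))
        ≈H ((U p q 1 *H V p q (m +ℕ n ∸ 1)) +H (V p q 1 *H U p q (m +ℕ n ∸ 1))))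
theorem2p5 R p q (suc m′) (suc k) (s≤s z≤n) (s≤s z≤n) =
    norm-shift 1 k
  , norm-closed-form k
  , Lucas-scalar (suc m′) (suc k)
  , Fibonacci-scalar (suc m′) (suc k)
  , H.trans (Lucas-product (suc m′) (suc k)) (H.sym (Lucas-product 1 (m′ +ℕ suc k)))
  , H.trans (mixed-product (suc m′) (suc k)) (H.sym (mixed-product 1 (m′ +ℕ suc k)))
  where
  open FibonacciLucasQuaternions R p q
  module H = Setoid (QuaternionAlgebra.H-setoid R)
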